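{- In typed call-by-name $\lambda\mu$-calculus, consider the equations $(\beta_\bot)$: $[\alpha]\mu\beta.t=t[\alpha/\beta]$; $(\eta_\bot)$: $\mu\alpha.[\alpha]t=t$ for $\alpha\notin FV(t)$; $(\beta'_\bot)$: $[\alpha]t=t$ for $t:\bot$ and $\alpha$ of type $\bot$; $(\zeta_\bot)$: $\mu\alpha.t=t\{[\alpha]v\mapsto v\}$ for $\alpha$ of type $\bot$ (i.e. every subterm $[\alpha]v$ of $t$ is replaced by $v$). Under the contextual (congruence) closure of $(\beta_\bot)$ and $(\eta_\bot)$, the equation $(\beta'_\bot)$ is equivalent to $(\zeta_\bot)$.
   Context: Call-by-name $\lambda\mu$-calculus: types $T::=$ base $\mid T\to U\mid T\times U\mid\bot$; terms $x\mid c\mid\lambda x.t\mid t\,u\mid\langle t,u\rangle\mid\mathrm{proj}_it\mid[\alpha]t\mid\mu\alpha.t$ where $\alpha$ ranges over $\mu$-variables; typing judgements $\Gamma\vdash t:T\mid\Delta$ with $\Delta$ a context of $\mu$-variables; $[\alpha]t:\bot$ when $t:T$ and $\alpha:T\in\Delta$; $\mu\alpha.t:T$ when $t:\bot$ in context $\Delta,\alpha:T$. Equations are between terms of the same type. "Equivalent" means each equation (as a scheme) is derivable in the congruence generated by the other together with $(\beta_\bot)$ and $(\eta_\bot)$. -}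

module Defs where

open import Data.List using (List; []; _∷_)
open import Data.Sum using (_⊎_; inj₁; inj₂)
open import Relation.Binary.PropositionalEquality using (_≡_; refl)

data Ty (B : Set) : Set where
  base : B → Ty B
  _⇒_  : Ty B → Ty B → Ty B
  _×̇_  : Ty B → Ty B → Ty B
  `⊥   : Ty B

infixr 7 _⇒_
infixr 8 _×̇_

data _∋_ {B : Set} : List (Ty B) → Ty B → Set where
  here  : ∀ {Γ A} → (A ∷ Γ) ∋ A
  there : ∀ {Γ A C} → Γ ∋ A → (C ∷ Γ) ∋ A

infix 4 _∋_

module Calc {B : Set} (K : Ty B → Set) where

  Ctx : Set
  Ctx = List (Ty B)

  -- Intrinsically typed terms: Term Γ Δ T  ≈  Γ ⊢ t : T ∣ Δ
  -- (Γ : λ-variables, Δ : μ-variables).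
  data Term (Γ Δ : Ctx) : Ty B → Set where
    var   : ∀ {T} → Γ ∋ T → Term Γ Δ T
    con   : ∀ {T} → K T → Term Γ Δ T
    lam   : ∀ {T U} → Term (T ∷ Γ) Δ U → Term Γ Δ (T ⇒ U)
    app   : ∀ {T U} → Term Γ Δ (T ⇒ U) → Term Γ Δ T → Term Γ Δ U
    pair  : ∀ {T U} → Term Γ Δ T → Term Γ Δ U → Term Γ Δ (T ×̇ U)
    proj₁ : ∀ {T U} → Term Γ Δ (T ×̇ U) → Term Γ Δ T
    proj₂ : ∀ {T U} → Term Γ Δ (T ×̇ U) → Term Γ Δ U
    name  : ∀ {T} → Δ ∋ T → Term Γ Δ T → Term Γ Δ `⊥
    mu    : ∀ {T} → Term Γ (T ∷ Δ) `⊥ → Term Γ Δ T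

  Renμ : Ctx → Ctx → Set
  Renμ Δ Δ' = ∀ {A} → Δ ∋ A → Δ' ∋ A

  liftμ : ∀ {Δ Δ' C} → Renμ Δ Δ' → Renμ (C ∷ Δ) (C ∷ Δ')
  liftμ ρ here      = here
  liftμ ρ (there x) = there (ρ x)

  renμ : ∀ {Γ Δ Δ' T} → Renμ Δ Δ' → Term Γ Δ T → Term Γ Δ' T
  renμ ρ (var x)     = var x
  renμ ρ (con c)     = con c
  renμ ρ (lam t)     = lam (renμ ρ t)
  renμ ρ (app t u)   = app (renμ ρ t) (renμ ρ u)
  renμ ρ (pair t u)  = pair (renμ ρ t) (renμ ρ u)
  renμ ρ (proj₁ t)   = proj₁ (renμ ρ t)
  renμ ρ (proj₂ t)   = proj₂ (renμ ρ t)
  renμ ρ (name α t)  = name (ρ α) (renμ ρ t)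
  renμ ρ (mu t)      = mu (renμ (liftμ ρ) t)

  -- Weakening by a fresh μ-variable (so that the new variable is not free).
  wkμ : ∀ {Γ Δ C T} → Term Γ Δ T → Term Γ (C ∷ Δ) T
  wkμ = renμ there

  -- The renaming β ↦ α used in t[α/β].
  [_/0] : ∀ {Δ T} → Δ ∋ T → Renμ (T ∷ Δ) Δ
  [ α /0] here      = α
  [ α /0] (there x) = x

  _─_ : (Δ : Ctx) {A : Ty B} → Δ ∋ A → Ctx
  (_ ∷ Δ) ─ here    = Δ
  (C ∷ Δ) ─ there x = C ∷ (Δ ─ x)

  del : ∀ {Δ A} (x : Δ ∋ `⊥) → Δ ∋ A → (A ≡ `⊥) ⊎ ((Δ ─ x) ∋ A)
  del here      here      = inj₁ refl
  del here      (there y) = inj₂ y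
  del (there x) here      = inj₂ here
  del (there x) (there y) with del x y
  ... | inj₁ e  = inj₁ e
  ... | inj₂ y' = inj₂ (there y')

  -- t{[α]v ↦ v}: replace every subterm [α]v by v (α of type ⊥),
  -- thereby removing α from the μ-context.
  erase : ∀ {Γ Δ T} (x : Δ ∋ `⊥) → Term Γ Δ T → Term Γ (Δ ─ x) T
  erase x (var y)     = var y
  erase x (con c)     = con c
  erase x (lam t)     = lam (erase x t)
  erase x (app t u)   = app (erase x t) (erase x u)
  erase x (pair t u)  = pair (erase x t) (erase x u)
  erase x (proj₁ t)   = proj₁ (erase x t)
  erase x (proj₂ t)   = proj₂ (erase x t)
  erase x (name y v) with del x y
  ... | inj₁ refl = erase x v
  ... | inj₂ y'   = name y' (erase x v)
  erase x (mu t)      = mu (erase (there x) t)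

  Axioms : Set₁
  Axioms = ∀ {Γ Δ T} → Term Γ Δ T → Term Γ Δ T → Set

  _∪_ : Axioms → Axioms → Axioms
  (E ∪ F) s t = E s t ⊎ F s t

  infixr 5 _∪_

  data Beta⊥ : Axioms where
    β⊥ : ∀ {Γ Δ T} (α : Δ ∋ T) (t : Term Γ (T ∷ Δ) `⊥) →
         Beta⊥ (name α (mu t)) (renμ [ α /0] t)

  data Eta⊥ : Axioms where
    η⊥ : ∀ {Γ Δ T} (t : Term Γ Δ T) → Eta⊥ (mu (name here (wkμ t))) t

  data Beta'⊥ : Axioms where
    β'⊥ : ∀ {Γ Δ} (α : Δ ∋ `⊥) (t : Term Γ Δ `⊥) → Beta'⊥ (name α t) t

  data Zeta⊥ : Axioms where
    ζ⊥ : ∀ {Γ Δ} (t : Term Γ (`⊥ ∷ Δ) `⊥) → Zeta⊥ (mu t) (erase here t)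

  data _⊢_≈_ (E : Axioms) : ∀ {Γ Δ T} → Term Γ Δ T → Term Γ Δ T → Set where
    ax     : ∀ {Γ Δ T} {s t : Term Γ Δ T} → E s t → E ⊢ s ≈ t
    refl≈  : ∀ {Γ Δ T} {t : Term Γ Δ T} → E ⊢ t ≈ t
    sym≈   : ∀ {Γ Δ T} {s t : Term Γ Δ T} → E ⊢ s ≈ t → E ⊢ t ≈ s
    trans≈ : ∀ {Γ Δ T} {s t u : Term Γ Δ T} → E ⊢ s ≈ t → E ⊢ t ≈ u → E ⊢ s ≈ u
    lam≈   : ∀ {Γ Δ T U} {s t : Term (T ∷ Γ) Δ U} → E ⊢ s ≈ t → E ⊢ lam s ≈ lam t
    app≈   : ∀ {Γ Δ T U} {s s' : Term Γ Δ (T ⇒ U)} {t t' : Term Γ Δ T} →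
             E ⊢ s ≈ s' → E ⊢ t ≈ t' → E ⊢ app s t ≈ app s' t'
    pair≈  : ∀ {Γ Δ T U} {s s' : Term Γ Δ T} {t t' : Term Γ Δ U} →
             E ⊢ s ≈ s' → E ⊢ t ≈ t' → E ⊢ pair s t ≈ pair s' t'
    proj₁≈ : ∀ {Γ Δ T U} {s t : Term Γ Δ (T ×̇ U)} → E ⊢ s ≈ t → E ⊢ proj₁ s ≈ proj₁ t
    proj₂≈ : ∀ {Γ Δ T U} {s t : Term Γ Δ (T ×̇ U)} → E ⊢ s ≈ t → E ⊢ proj₂ s ≈ proj₂ t
    name≈  : ∀ {Γ Δ T} (α : Δ ∋ T) {s t : Term Γ Δ T} → E ⊢ s ≈ t → E ⊢ name α s ≈ name α t
    mu≈    : ∀ {Γ Δ T} {s t : Term Γ (T ∷ Δ) `⊥} → E ⊢ s ≈ t → E ⊢ mu s ≈ mu t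

  Derives : Axioms → Axioms → Set
  Derives E F = ∀ {Γ Δ T} {s t : Term Γ Δ T} → F s t → E ⊢ s ≈ t

-- With α : ⊥, (β'⊥) rewrites each [α]v in t to v, so t = t' := t{[α]v ↦ v} with
-- α no longer free, and μα.t = μα.[α]t' = t' by (β'⊥) backwards and (η⊥).
-- Conversely, if α is not free in t : ⊥ then (ζ⊥) gives μβ.t = t, hence
-- [α]t = [α]μβ.t = t by (β⊥).
module Submission where

open import Defs
open import Data.List using (_∷_)
open import Data.Product using (_×_; _,_)
open import Data.Sum using (inj₁; inj₂)
open import Function using (_∘_)
open import Relation.Binary.PropositionalEquality using (_≡_; refl; trans; cong; cong₂)

module _ {B : Set} {K : Ty B → Set} where
  open Calc K

  ≡⇒≈ : ∀ {E : Axioms} {Γ Δ T} {s t : Term Γ Δ T} → s ≡ t → E ⊢ s ≈ t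
  ≡⇒≈ refl = refl≈

  renμ-id : ∀ {Γ Δ T} (ρ : Renμ Δ Δ) → (∀ {A} (x : Δ ∋ A) → ρ x ≡ x) →
            (t : Term Γ Δ T) → renμ ρ t ≡ t
  renμ-id ρ h (var x)    = refl
  renμ-id ρ h (con c)    = refl
  renμ-id ρ h (lam t)    = cong lam (renμ-id ρ h t)
  renμ-id ρ h (app t u)  = cong₂ app (renμ-id ρ h t) (renμ-id ρ h u)
  renμ-id ρ h (pair t u) = cong₂ pair (renμ-id ρ h t) (renμ-id ρ h u)
  renμ-id ρ h (proj₁ t)  = cong proj₁ (renμ-id ρ h t)
  renμ-id ρ h (proj₂ t)  = cong proj₂ (renμ-id ρ h t)
  renμ-id ρ h (name α t) = cong₂ name (h α) (renμ-id ρ h t)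
  renμ-id ρ h (mu t)     = cong mu (renμ-id (liftμ ρ) h↑ t)
    where
    h↑ : ∀ {A} (x : _ ∋ A) → liftμ ρ x ≡ x
    h↑ here      = refl
    h↑ (there x) = cong there (h x)

  renμ-∘ : ∀ {Γ Δ Δ' Δ'' T} (ρ : Renμ Δ' Δ'') (σ : Renμ Δ Δ') (τ : Renμ Δ Δ'') →
           (∀ {A} (x : Δ ∋ A) → ρ (σ x) ≡ τ x) →
           (t : Term Γ Δ T) → renμ ρ (renμ σ t) ≡ renμ τ t
  renμ-∘ ρ σ τ h (var x)    = refl
  renμ-∘ ρ σ τ h (con c)    = refl
  renμ-∘ ρ σ τ h (lam t)    = cong lam (renμ-∘ ρ σ τ h t)
  renμ-∘ ρ σ τ h (app t u)  = cong₂ app (renμ-∘ ρ σ τ h t) (renμ-∘ ρ σ τ h u)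
  renμ-∘ ρ σ τ h (pair t u) = cong₂ pair (renμ-∘ ρ σ τ h t) (renμ-∘ ρ σ τ h u)
  renμ-∘ ρ σ τ h (proj₁ t)  = cong proj₁ (renμ-∘ ρ σ τ h t)
  renμ-∘ ρ σ τ h (proj₂ t)  = cong proj₂ (renμ-∘ ρ σ τ h t)
  renμ-∘ ρ σ τ h (name α t) = cong₂ name (h α) (renμ-∘ ρ σ τ h t)
  renμ-∘ ρ σ τ h (mu t)     = cong mu (renμ-∘ (liftμ ρ) (liftμ σ) (liftμ τ) h↑ t)
    where
    h↑ : ∀ {A} (x : _ ∋ A) → liftμ ρ (liftμ σ x) ≡ liftμ τ x
    h↑ here      = refl
    h↑ (there x) = cong there (h x)

  [/0]-wkμ : ∀ {Γ Δ T U} (α : Δ ∋ U) (t : Term Γ Δ T) → renμ [ α /0] (wkμ t) ≡ t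
  [/0]-wkμ α t = trans (renμ-∘ [ α /0] there (λ x → x) (λ _ → refl) t)
                        (renμ-id (λ x → x) (λ _ → refl) t)

  erase-renμ : ∀ {Γ Δ Δ' T} (x : Δ' ∋ `⊥) (σ : Renμ Δ Δ') (τ : Renμ Δ (Δ' ─ x)) →
               (∀ {A} (y : Δ ∋ A) → del x (σ y) ≡ inj₂ (τ y)) →
               (t : Term Γ Δ T) → erase x (renμ σ t) ≡ renμ τ t
  erase-renμ x σ τ h (var y)    = refl
  erase-renμ x σ τ h (con c)    = refl
  erase-renμ x σ τ h (lam t)    = cong lam (erase-renμ x σ τ h t)
  erase-renμ x σ τ h (app t u)  = cong₂ app (erase-renμ x σ τ h t) (erase-renμ x σ τ h u)
  erase-renμ x σ τ h (pair t u) = cong₂ pair (erase-renμ x σ τ h t) (erase-renμ x σ τ h u)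
  erase-renμ x σ τ h (proj₁ t)  = cong proj₁ (erase-renμ x σ τ h t)
  erase-renμ x σ τ h (proj₂ t)  = cong proj₂ (erase-renμ x σ τ h t)
  erase-renμ x σ τ h (name y v) rewrite h y = cong (name (τ y)) (erase-renμ x σ τ h v)
  erase-renμ x σ τ h (mu t)     = cong mu (erase-renμ (there x) (liftμ σ) (liftμ τ) h↑ t)
    where
    h↑ : ∀ {A} (y : _ ∋ A) → del (there x) (liftμ σ y) ≡ inj₂ (liftμ τ y)
    h↑ here      = refl
    h↑ (there y) rewrite h y = refl

  erase-wkμ : ∀ {Γ Δ T} (t : Term Γ Δ T) → erase here (wkμ t) ≡ t
  erase-wkμ t = trans (erase-renμ here there (λ y → y) (λ _ → refl) t)
                      (renμ-id (λ y → y) (λ _ → refl) t)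

  Reinserts : ∀ {Δ} (x : Δ ∋ `⊥) → Renμ (Δ ─ x) Δ → Set
  Reinserts {Δ} x ρ = ∀ {A} (y : Δ ∋ A) {y'} → del x y ≡ inj₂ y' → ρ y' ≡ y

  reinserts-here : ∀ {Δ} → Reinserts {`⊥ ∷ Δ} here there
  reinserts-here (there y) refl = refl

  reinserts-there : ∀ {Δ C} (x : Δ ∋ `⊥) (ρ : Renμ (Δ ─ x) Δ) →
                    Reinserts x ρ → Reinserts {C ∷ Δ} (there x) (liftμ ρ)
  reinserts-there x ρ h here refl = refl
  reinserts-there x ρ h (there y) eq with del x y in e
  reinserts-there x ρ h (there y) refl | inj₂ y' = cong there (h y e)

  ≈-erase : ∀ {E : Axioms} → Derives E Beta'⊥ →
            ∀ {Γ Δ T} (x : Δ ∋ `⊥) (ρ : Renμ (Δ ─ x) Δ) → Reinserts x ρ →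
            (t : Term Γ Δ T) → E ⊢ t ≈ renμ ρ (erase x t)
  ≈-erase d x ρ h (var y)    = refl≈
  ≈-erase d x ρ h (con c)    = refl≈
  ≈-erase d x ρ h (lam t)    = lam≈ (≈-erase d x ρ h t)
  ≈-erase d x ρ h (app t u)  = app≈ (≈-erase d x ρ h t) (≈-erase d x ρ h u)
  ≈-erase d x ρ h (pair t u) = pair≈ (≈-erase d x ρ h t) (≈-erase d x ρ h u)
  ≈-erase d x ρ h (proj₁ t)  = proj₁≈ (≈-erase d x ρ h t)
  ≈-erase d x ρ h (proj₂ t)  = proj₂≈ (≈-erase d x ρ h t)
  ≈-erase d x ρ h (name y v) with del x y in e
  ... | inj₁ refl = trans≈ (d (β'⊥ y v)) (≈-erase d x ρ h v)
  ... | inj₂ y' rewrite h y e = name≈ y (≈-erase d x ρ h v)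
  ≈-erase d x ρ h (mu t)     =
    mu≈ (≈-erase d (there x) (liftμ ρ) (reinserts-there x ρ h) t)

  beta'⊥⇒zeta⊥ : ∀ {E : Axioms} → Derives E Beta'⊥ → Derives E Eta⊥ → Derives E Zeta⊥
  beta'⊥⇒zeta⊥ β' η (ζ⊥ t) =
    trans≈ (mu≈ (≈-erase β' here there reinserts-here t))
   (trans≈ (mu≈ (sym≈ (β' (β'⊥ here (wkμ t')))))
           (η (η⊥ t')))
    where t' = erase here t

  beta⊥∧zeta⊥⇒beta'⊥ : ∀ {E : Axioms} → Derives E Beta⊥ → Derives E Zeta⊥ → Derives E Beta'⊥
  beta⊥∧zeta⊥⇒beta'⊥ β ζ (β'⊥ α t) =
    trans≈ (name≈ α (sym≈ (trans≈ (ζ (ζ⊥ (wkμ t))) (≡⇒≈ (erase-wkμ t)))))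
   (trans≈ (β (β⊥ α (wkμ t)))
           (≡⇒≈ ([/0]-wkμ α t)))

mainTheorem14 : {B : Set} (K : Ty B → Set) →
    let open Calc K in
    Derives (Beta⊥ ∪ Eta⊥ ∪ Beta'⊥) Zeta⊥ × Derives (Beta⊥ ∪ Eta⊥ ∪ Zeta⊥) Beta'⊥
mainTheorem14 K =
    beta'⊥⇒zeta⊥ (ax ∘ inj₂ ∘ inj₂) (ax ∘ inj₂ ∘ inj₁)
  , beta⊥∧zeta⊥⇒beta'⊥ (ax ∘ inj₁) (ax ∘ inj₂ ∘ inj₂)
  where open Calc K
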